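{- For every integer $t\geq 2$, there exists a connected graph $G$ such that $fix(G)=t$ and $F_{xt}(G)=t+1$.
   Context: All graphs are finite and simple. A fixing set of $G$ is a set $F\subseteq V(G)$ such that the only automorphism fixing every vertex of $F$ is the identity; $fix(G)$ is the minimum size of a fixing set. A fixatic partition is a partition of $V(G)$ into classes each of which is a fixing set; $F_{xt}(G)$ is the maximum number of classes in a fixatic partition. -}

module Defs where

open import Data.Nat using (ℕ; suc; _≤_)
open import Data.Bool using (Bool; true; false)
open import Data.Fin using (Fin)
open import Data.Fin.Subset using (Subset; _∈_; ∣_∣)
open import Data.Fin.Permutation using (Permutation′; _⟨$⟩ʳ_)
open import Data.Product using (Σ; _×_; ∃)
open import Relation.Binary.PropositionalEquality using (_≡_)

record Graph : Set where
  field
    n      : ℕ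
    adj    : Fin n → Fin n → Bool
    sym    : ∀ u v → adj u v ≡ adj v u
    irrefl : ∀ v → adj v v ≡ false

open Graph public

data Reach (G : Graph) : Fin (n G) → Fin (n G) → Set where
  here : ∀ {u} → Reach G u u
  step : ∀ {u v w} → adj G u v ≡ true → Reach G v w → Reach G u w

Connected : Graph → Set
Connected G = ∀ u v → Reach G u v

IsAutomorphism : (G : Graph) → Permutation′ (n G) → Set
IsAutomorphism G σ = ∀ u v → adj G (σ ⟨$⟩ʳ u) (σ ⟨$⟩ʳ v) ≡ adj G u v

IsFixingPred : (G : Graph) → (Fin (n G) → Set) → Set
IsFixingPred G F = ∀ (σ : Permutation′ (n G)) → IsAutomorphism G σ →
  (∀ v → F v → σ ⟨$⟩ʳ v ≡ v) → ∀ v → σ ⟨$⟩ʳ v ≡ v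

IsFixingSet : (G : Graph) → Subset (n G) → Set
IsFixingSet G F = IsFixingPred G (λ v → v ∈ F)

FixNumberIs : Graph → ℕ → Set
FixNumberIs G t =
  (Σ (Subset (n G)) λ F → IsFixingSet G F × ∣ F ∣ ≡ t)
  × (∀ (F : Subset (n G)) → IsFixingSet G F → t ≤ ∣ F ∣)

IsFixaticPartition : (G : Graph) (k : ℕ) → (Fin (n G) → Fin k) → Set
IsFixaticPartition G k c =
  (∀ (i : Fin k) → ∃ λ v → c v ≡ i)
  × (∀ (i : Fin k) → IsFixingPred G (λ v → c v ≡ i))

FixaticNumberIs : Graph → ℕ → Set
FixaticNumberIs G m =
  (Σ (Fin (n G) → Fin m) λ c → IsFixaticPartition G m c)
  × (∀ (k : ℕ) (c : Fin (n G) → Fin k) → IsFixaticPartition G k c → k ≤ m)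

module Submission where

-- The graph realising fix(G) = t and F_xt(G) = t + 1 is the spider with
-- t + 1 legs, each a path of t vertices attached to a common centre.
--
-- The centre is the only vertex with three distinct
-- neighbours, so every automorphism fixes it; walking outwards level by
-- level, it then maps each leg rigidly onto a leg.  Conversely every
-- permutation of the legs is an automorphism.
--
-- Consequently a vertex set is fixing exactly when it
-- meets all legs but at most one: if it misses two legs, swapping them
-- is a non-trivial automorphism fixing it; if it meets all others, the
-- induced leg permutation fixes all legs but one, hence all of them.
-- So fix(G) = t, witnessed by the first vertices of t legs.
--
-- Every class meets t legs, so q classes contain
-- q·t vertices on legs, whereas the legs hold (t + 1)·t vertices: q ≤ t + 1.
-- Colouring vertex j of leg a with punchIn a j gives t + 1 classes, each
-- meeting every leg but its own.

open import Data.Bool using (Bool; true; false; _∨_)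
import Data.Bool.Properties as BP
open import Data.Empty using (⊥-elim)
open import Data.Fin as F using (Fin; zero; suc; toℕ; inject₁; punchIn; punchOut; combine; remQuot)
import Data.Fin.Properties as FP
open import Data.Fin.Induction using (<-weakInduction)
open import Data.Fin.Patterns using (0F; 1F; 2F)
open import Data.Fin.Permutation using (Permutation′; _⟨$⟩ʳ_; _⟨$⟩ˡ_; inverseˡ; inverseʳ; permutation; transpose)
open import Data.Fin.Subset using (Subset; _∈_; _∉_; ∣_∣; _-_; ⁅_⁆; inside; outside) renaming (⊥ to ∅)
import Data.Fin.Subset.Properties as SP
open import Data.Nat using (ℕ; zero; suc; _*_; _≤_; z≤n; s≤s)
import Data.Nat.Properties as ℕP
open import Data.Product using (Σ; _×_; _,_; proj₁; proj₂; ∃; uncurry)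
open import Data.Sum using (_⊎_; inj₁; inj₂)
open import Data.Vec using (_∷_; there; tabulate)
import Data.Vec.Properties as VP
open import Function using (_∘_)
open import Function.Definitions using (Injective)
open import Relation.Binary.Definitions using (DecidableEquality)
open import Relation.Nullary using (Dec; yes; no; does; ¬_; ¬?)
open import Relation.Nullary.Decidable using (dec-true; dec-false; decidable-stable)
open import Relation.Unary using (Decidable)
open import Relation.Binary.PropositionalEquality
open import Defs hiding (sym; irrefl)

does⇒ : ∀ {A : Set} (d : Dec A) → does d ≡ true → A
does⇒ (yes a) _ = a
does⇒ (no _) ()

does-injective : ∀ {A B : Set} (_≟A_ : DecidableEquality A) (_≟B_ : DecidableEquality B)
  (f : A → B) → Injective _≡_ _≡_ f → ∀ x y → does (f x ≟B f y) ≡ does (x ≟A y)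
does-injective _≟A_ _≟B_ f inj x y with x ≟A y
... | yes refl = dec-true (f x ≟B f x) refl
... | no x≢y = dec-false (f x ≟B f y) (x≢y ∘ inj)

x∉p-x : ∀ {n} (p : Subset n) (x : Fin n) → x ∉ p - x
x∉p-x (outside ∷ p) zero ()
x∉p-x (inside ∷ p) zero ()
x∉p-x (s ∷ p) (suc x) (there x∈p-x) = x∉p-x p x x∈p-x

∣p∣≤1+∣p-x∣ : ∀ {n} (p : Subset n) (x : Fin n) → ∣ p ∣ ≤ suc ∣ p - x ∣
∣p∣≤1+∣p-x∣ (outside ∷ p) zero =
  subst (λ q → ∣ p ∣ ≤ suc ∣ q ∣) (sym (SP.p─⊥≡p p)) (ℕP.n≤1+n ∣ p ∣)
∣p∣≤1+∣p-x∣ (inside ∷ p) zero =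
  subst (λ q → suc ∣ p ∣ ≤ suc ∣ q ∣) (sym (SP.p─⊥≡p p)) ℕP.≤-refl
∣p∣≤1+∣p-x∣ (outside ∷ p) (suc x) = ∣p∣≤1+∣p-x∣ p x
∣p∣≤1+∣p-x∣ (inside ∷ p) (suc x) = s≤s (∣p∣≤1+∣p-x∣ p x)

injection⇒≤∣∣ : ∀ {k n} (p : Subset n) (f : Fin k → Fin n) →
  Injective _≡_ _≡_ f → (∀ j → f j ∈ p) → k ≤ ∣ p ∣
injection⇒≤∣∣ {zero} p f inj f∈p = z≤n
injection⇒≤∣∣ {suc k} p f inj f∈p =
  ℕP.≤-trans (s≤s rest) (SP.x∈p⇒∣p-x∣<∣p∣ (f∈p zero))
  where
  rest : k ≤ ∣ p - f zero ∣
  rest = injection⇒≤∣∣ (p - f zero) (f ∘ suc) (FP.suc-injective ∘ inj)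
           (λ j → SP.x∈p∧x≢y⇒x∈p-y (f∈p (suc j)) (λ e → FP.0≢1+n (sym (inj e))))

covered⇒∣∣≤ : ∀ {k n} (p : Subset n) (f : Fin k → Fin n) →
  (∀ {v} → v ∈ p → ∃ λ j → f j ≡ v) → ∣ p ∣ ≤ k
covered⇒∣∣≤ {zero} {n} p f cov = ℕP.≤-reflexive (trans (cong ∣_∣ p≡∅) (SP.∣⊥∣≡0 n))
  where
  p≡∅ : p ≡ ∅
  p≡∅ = SP.Empty-unique (λ (v , v∈p) → FP.¬Fin0 (proj₁ (cov v∈p)))
covered⇒∣∣≤ {suc k} p f cov =
  ℕP.≤-trans (∣p∣≤1+∣p-x∣ p (f zero)) (s≤s (covered⇒∣∣≤ (p - f zero) (f ∘ suc) cov′))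
  where
  cov′ : ∀ {v} → v ∈ p - f zero → ∃ λ j → f (suc j) ≡ v
  cov′ {v} v∈p-f0 with cov (SP.p─q⊆p p ⁅ f zero ⁆ v∈p-f0)
  ... | zero , refl = ⊥-elim (x∉p-x p v v∈p-f0)
  ... | suc j , e = j , e

image : ∀ {k n} → (Fin k → Fin n) → Subset n
image f = tabulate λ v → does (FP.any? λ j → f j F.≟ v)

∈-image⁺ : ∀ {k n} (f : Fin k → Fin n) j → f j ∈ image f
∈-image⁺ f j = VP.lookup⇒[]= (f j) (image f)
  (trans (VP.lookup∘tabulate _ (f j)) (dec-true (FP.any? λ i → f i F.≟ f j) (j , refl)))

∈-image⁻ : ∀ {k n} (f : Fin k → Fin n) {v} → v ∈ image f → ∃ λ j → f j ≡ v
∈-image⁻ f {v} v∈img = does⇒ (FP.any? λ j → f j F.≟ v)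
  (trans (sym (VP.lookup∘tabulate _ v)) (VP.[]=⇒lookup v∈img))

∣image∣ : ∀ {k n} (f : Fin k → Fin n) → Injective _≡_ _≡_ f → ∣ image f ∣ ≡ k
∣image∣ f inj = ℕP.≤-antisym (covered⇒∣∣≤ (image f) f (∈-image⁻ f))
                             (injection⇒≤∣∣ (image f) f inj (∈-image⁺ f))

pairInjection⇒*≤ : ∀ {a b c d} (f : Fin a × Fin b → Fin c × Fin d) →
  Injective _≡_ _≡_ f → a * b ≤ c * d
pairInjection⇒*≤ {a} {b} {c} {d} f inj = FP.injective⇒≤ code-injective
  where
  code : Fin (a * b) → Fin (c * d)
  code = uncurry combine ∘ f ∘ remQuot {a} b
  code-injective : Injective _≡_ _≡_ code
  code-injective {x} {y} e = begin
    x                                 ≡⟨ sym (FP.combine-remQuot {a} b x) ⟩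
    uncurry combine (remQuot {a} b x) ≡⟨ cong (uncurry combine) (inj (uncurry (cong₂ _,_) (FP.combine-injective _ _ _ _ e))) ⟩
    uncurry combine (remQuot {a} b y) ≡⟨ FP.combine-remQuot {a} b y ⟩
    y                                 ∎
    where open ≡-Reasoning

Reach-trans : ∀ {G u v w} → Reach G u v → Reach G v w → Reach G u w
Reach-trans here q = q
Reach-trans (step e p) q = step e (Reach-trans p q)

Reach-sym : ∀ {G u v} → Reach G u v → Reach G v u
Reach-sym here = here
Reach-sym {G} {u} (step {v = v} e p) =
  Reach-trans (Reach-sym p) (step (trans (Graph.sym G v u) e) here)

hub⇒connected : ∀ G (h : Fin (n G)) → (∀ u → Reach G u h) → Connected G
hub⇒connected G h toHub u v = Reach-trans (toHub u) (Reach-sym (toHub v))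

-- A graph presented on a type V of vertices labelled bijectively by Fin N.
-- Automorphisms are read on V, and adjacency-preserving permutations of V
-- are turned into automorphisms.
module Labelled {V : Set} {N : ℕ} (enc : V → Fin N) (dec : Fin N → V)
  (dec-enc : ∀ x → dec (enc x) ≡ x) (enc-dec : ∀ v → enc (dec v) ≡ v)
  (adjV : V → V → Bool) (adjV-sym : ∀ x y → adjV x y ≡ adjV y x)
  (adjV-irrefl : ∀ x → adjV x x ≡ false) where

  graph : Graph
  graph = record { n = N ; adj = λ u v → adjV (dec u) (dec v)
                 ; sym = λ u v → adjV-sym (dec u) (dec v)
                 ; irrefl = λ v → adjV-irrefl (dec v) }

  adj-enc : ∀ x y → adj graph (enc x) (enc y) ≡ adjV x y
  adj-enc x y = cong₂ adjV (dec-enc x) (dec-enc y)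

  enc-injective : Injective _≡_ _≡_ enc
  enc-injective {x} {y} e = trans (sym (dec-enc x)) (trans (cong dec e) (dec-enc y))

  edge : ∀ {x y} → adjV x y ≡ true → Reach graph (enc x) (enc y)
  edge {x} {y} e = step (trans (adj-enc x y) e) here

  connectedVia : (h : V) → (∀ x → Reach graph (enc x) (enc h)) → Connected graph
  connectedVia h toHub = hub⇒connected graph (enc h) λ u →
    subst (λ w → Reach graph w (enc h)) (enc-dec u) (toHub (dec u))

  module OnV (σ : Permutation′ N) (aut : IsAutomorphism graph σ) where
    σV : V → V
    σV x = dec (σ ⟨$⟩ʳ enc x)

    σV-adj : ∀ x y → adjV (σV x) (σV y) ≡ adjV x y
    σV-adj x y = trans (aut (enc x) (enc y)) (adj-enc x y)

    σV-injective : Injective _≡_ _≡_ σV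
    σV-injective {x} {y} e = enc-injective (begin
      enc x                         ≡⟨ sym (inverseˡ σ) ⟩
      σ ⟨$⟩ˡ (σ ⟨$⟩ʳ enc x)         ≡⟨ cong (σ ⟨$⟩ˡ_) (trans (sym (enc-dec _)) (trans (cong enc e) (enc-dec _))) ⟩
      σ ⟨$⟩ˡ (σ ⟨$⟩ʳ enc y)         ≡⟨ inverseˡ σ ⟩
      enc y                         ∎)
      where open ≡-Reasoning

    fixed⇒σV-fixed : ∀ x → σ ⟨$⟩ʳ enc x ≡ enc x → σV x ≡ x
    fixed⇒σV-fixed x e = trans (cong dec e) (dec-enc x)

    σV-identity⇒identity : (∀ x → σV x ≡ x) → ∀ v → σ ⟨$⟩ʳ v ≡ v
    σV-identity⇒identity σV-id v = begin
      σ ⟨$⟩ʳ v               ≡⟨ cong (σ ⟨$⟩ʳ_) (sym (enc-dec v)) ⟩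
      σ ⟨$⟩ʳ enc (dec v)     ≡⟨ sym (enc-dec _) ⟩
      enc (σV (dec v))       ≡⟨ cong enc (σV-id (dec v)) ⟩
      enc (dec v)            ≡⟨ enc-dec v ⟩
      v                      ∎
      where open ≡-Reasoning

  module Lift (τ τ⁻¹ : V → V) (τ∘τ⁻¹ : ∀ x → τ (τ⁻¹ x) ≡ x) (τ⁻¹∘τ : ∀ x → τ⁻¹ (τ x) ≡ x) where
    lifted : Permutation′ N
    lifted = permutation (enc ∘ τ ∘ dec) (enc ∘ τ⁻¹ ∘ dec) (cancel τ τ⁻¹ τ∘τ⁻¹) (cancel τ⁻¹ τ τ⁻¹∘τ)
      where
      cancel : ∀ f g → (∀ x → f (g x) ≡ x) → ∀ v → enc (f (dec (enc (g (dec v))))) ≡ v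
      cancel f g fg v = trans (cong (enc ∘ f) (dec-enc _)) (trans (cong enc (fg (dec v))) (enc-dec v))

    lifted-enc : ∀ x → lifted ⟨$⟩ʳ enc x ≡ enc (τ x)
    lifted-enc x = cong (enc ∘ τ) (dec-enc x)

    lifted-automorphism : (∀ x y → adjV (τ x) (τ y) ≡ adjV x y) → IsAutomorphism graph lifted
    lifted-automorphism pres u v = trans (adj-enc (τ (dec u)) (τ (dec v))) (pres (dec u) (dec v))

    lifted-fixes : (P : Fin N → Set) → (∀ x → P (enc x) → τ x ≡ x) → ∀ v → P v → lifted ⟨$⟩ʳ v ≡ v
    lifted-fixes P fixes v pv =
      trans (cong enc (fixes (dec v) (subst P (sym (enc-dec v)) pv))) (enc-dec v)

transpose-first : ∀ {n} (a b : Fin n) → transpose a b ⟨$⟩ʳ a ≡ b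
transpose-first a b rewrite dec-true (a F.≟ a) refl = refl

transpose-others : ∀ {n} {a b c : Fin n} → c ≢ a → c ≢ b → transpose a b ⟨$⟩ʳ c ≡ c
transpose-others {a = a} {b} {c} c≢a c≢b
  rewrite dec-false (c F.≟ a) c≢a | dec-false (c F.≟ b) c≢b = refl

-- The spider with L = 3 + r legs, each a path of m = 1 + s vertices.
-- Vertex leg a j is the (j+1)-th vertex of leg a counted from the centre.
module Spider (r s : ℕ) where
  k L m : ℕ
  k = suc (suc r)
  L = suc k
  m = suc s

  data V : Set where
    centre : V
    leg    : Fin L → Fin m → V

  leg-injective : ∀ {a b i j} → leg a i ≡ leg b j → a ≡ b × i ≡ j
  leg-injective refl = refl , refl

  _≟V_ : DecidableEquality V
  centre ≟V centre = yes refl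
  centre ≟V leg _ _ = no λ ()
  leg _ _ ≟V centre = no λ ()
  leg a i ≟V leg b j with a F.≟ b | i F.≟ j
  ... | yes refl | yes refl = yes refl
  ... | no a≢b   | _        = no (a≢b ∘ proj₁ ∘ leg-injective)
  ... | yes _    | no i≢j   = no (i≢j ∘ proj₂ ∘ leg-injective)

  parent : Fin L → Fin m → V
  parent a zero = centre
  parent a (suc i) = leg a (inject₁ i)

  depth : V → ℕ
  depth centre = 0
  depth (leg _ j) = suc (toℕ j)

  depth-parent : ∀ a j → depth (parent a j) ≡ toℕ j
  depth-parent a zero = refl
  depth-parent a (suc i) = cong suc (FP.toℕ-inject₁ i)

  parent≢self : ∀ a j → parent a j ≢ leg a j
  parent≢self a j e = ℕP.1+n≢n (sym (trans (sym (depth-parent a j)) (cong depth e)))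

  parent≢grandchild : ∀ a i → leg a (suc i) ≢ parent a (inject₁ i)
  parent≢grandchild a i e = ℕP.m≢1+n+m (toℕ i) {1} (sym (begin
    suc (suc (toℕ i))            ≡⟨ cong depth e ⟩
    depth (parent a (inject₁ i)) ≡⟨ depth-parent a (inject₁ i) ⟩
    toℕ (inject₁ i)              ≡⟨ FP.toℕ-inject₁ i ⟩
    toℕ i                        ∎))
    where open ≡-Reasoning

  parent-injective : ∀ {a b i j} → parent a i ≡ parent b j → parent a i ≢ centre → leg a i ≡ leg b j
  parent-injective {i = zero} _ p≢centre = ⊥-elim (p≢centre refl)
  parent-injective {i = suc i} {j = zero} () _
  parent-injective {i = suc i} {j = suc j} e _ with leg-injective e
  ... | refl , e′ = cong (leg _ ∘ suc) (FP.inject₁-injective e′)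

  data ChildOf : V → V → Set where
    child : ∀ {x} b j → parent b j ≡ x → ChildOf (leg b j) x

  children-unique : ∀ {x y y′} → ChildOf y x → ChildOf y′ x → x ≢ centre → y ≡ y′
  children-unique (child _ _ refl) (child _ _ e′) x≢centre = parent-injective (sym e′) x≢centre

  _parentOf_ : V → V → Bool
  x parentOf centre = false
  x parentOf leg b j = does (x ≟V parent b j)

  adjV : V → V → Bool
  adjV x y = x parentOf y ∨ y parentOf x

  adjV-sym : ∀ x y → adjV x y ≡ adjV y x
  adjV-sym x y = BP.∨-comm (x parentOf y) (y parentOf x)

  adjV-irrefl : ∀ x → adjV x x ≡ false
  adjV-irrefl centre = refl
  adjV-irrefl (leg b j) rewrite dec-false (leg b j ≟V parent b j) (parent≢self b j ∘ sym) = refl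

  child⇒adjacent : ∀ {x y} → ChildOf y x → adjV x y ≡ true
  child⇒adjacent (child b j refl) rewrite dec-true (parent b j ≟V parent b j) refl = refl

  parentOf⇒child : ∀ x y → x parentOf y ≡ true → ChildOf y x
  parentOf⇒child x centre ()
  parentOf⇒child x (leg b j) p = child b j (sym (does⇒ (x ≟V parent b j) p))

  adjacent⇒related : ∀ x y → adjV x y ≡ true → ChildOf y x ⊎ ChildOf x y
  adjacent⇒related x y e with x parentOf y in x-parent
  ... | true = inj₁ (parentOf⇒child x y x-parent)
  ... | false = inj₂ (parentOf⇒child y x e)

  toParent : ∀ b j → adjV (leg b j) (parent b j) ≡ true
  toParent b j = trans (adjV-sym (leg b j) (parent b j)) (child⇒adjacent (child b j refl))

  legNeighbour : ∀ {b j y} → adjV (leg b j) y ≡ true → y ≡ parent b j ⊎ ChildOf y (leg b j)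
  legNeighbour {b} {j} {y} e with adjacent⇒related (leg b j) y e
  ... | inj₁ c = inj₂ c
  ... | inj₂ (child _ _ e′) = inj₁ (sym e′)

  legNeighbours≤2 : ∀ {b j y₁ y₂ y₃} → adjV (leg b j) y₁ ≡ true → adjV (leg b j) y₂ ≡ true →
    adjV (leg b j) y₃ ≡ true → y₁ ≡ y₂ ⊎ y₁ ≡ y₃ ⊎ y₂ ≡ y₃
  legNeighbours≤2 {b} {j} {y₁} {y₂} {y₃} e₁ e₂ e₃ =
    coincide (legNeighbour e₁) (legNeighbour e₂) (legNeighbour e₃)
    where
    Kind : V → Set
    Kind y = y ≡ parent b j ⊎ ChildOf y (leg b j)
    same : ∀ {y y′} → ChildOf y (leg b j) → ChildOf y′ (leg b j) → y ≡ y′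
    same c c′ = children-unique c c′ λ ()
    coincide : Kind y₁ → Kind y₂ → Kind y₃ → y₁ ≡ y₂ ⊎ y₁ ≡ y₃ ⊎ y₂ ≡ y₃
    coincide (inj₁ p₁) (inj₁ p₂) _         = inj₁ (trans p₁ (sym p₂))
    coincide (inj₁ p₁) (inj₂ _)  (inj₁ p₃) = inj₂ (inj₁ (trans p₁ (sym p₃)))
    coincide (inj₁ _)  (inj₂ c₂) (inj₂ c₃) = inj₂ (inj₂ (same c₂ c₃))
    coincide (inj₂ _)  (inj₁ p₂) (inj₁ p₃) = inj₂ (inj₂ (trans p₂ (sym p₃)))
    coincide (inj₂ c₁) (inj₁ _)  (inj₂ c₃) = inj₂ (inj₁ (same c₁ c₃))
    coincide (inj₂ c₁) (inj₂ c₂) _         = inj₁ (same c₁ c₂)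

  centreNeighbour : ∀ {y} → adjV centre y ≡ true → ∃ λ b → y ≡ leg b zero
  centreNeighbour {y} e with adjacent⇒related centre y e
  ... | inj₁ (child b zero _) = b , refl
  ... | inj₁ (child b (suc i) ())
  ... | inj₂ ()

  N : ℕ
  N = suc (L * m)

  enc : V → Fin N
  enc centre = zero
  enc (leg a j) = suc (combine a j)

  dec : Fin N → V
  dec zero = centre
  dec (suc v) = uncurry leg (remQuot m v)

  dec-enc : ∀ x → dec (enc x) ≡ x
  dec-enc centre = refl
  dec-enc (leg a j) = cong (uncurry leg) (FP.remQuot-combine a j)

  enc-dec : ∀ v → enc (dec v) ≡ v
  enc-dec zero = refl
  enc-dec (suc v) = cong suc (FP.combine-remQuot {L} m v)

  open Labelled enc dec dec-enc enc-dec adjV adjV-sym adjV-irrefl public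

  connected : Connected graph
  connected = connectedVia centre λ { centre → here ; (leg a j) → legReachesCentre a j }
    where
    legReachesCentre : ∀ a j → Reach graph (enc (leg a j)) (enc centre)
    legReachesCentre a = <-weakInduction (λ j → Reach graph (enc (leg a j)) (enc centre))
      (edge {leg a zero} {centre} (toParent a zero))
      (λ i down → Reach-trans (edge {leg a (suc i)} {leg a (inject₁ i)} (toParent a (suc i))) down)

  module Automorphism (σ : Permutation′ N) (aut : IsAutomorphism graph σ) where
    open OnV σ aut public

    σV-preserves-adjacency : ∀ {x y} → adjV x y ≡ true → adjV (σV x) (σV y) ≡ true
    σV-preserves-adjacency {x} {y} e = trans (σV-adj x y) e

    -- The centre has three distinct neighbours, a leg vertex at most two.
    centre-fixed : σV centre ≡ centre
    centre-fixed with σV centre in σcentre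
    ... | centre = refl
    ... | leg b j = ⊥-elim (distinct (legNeighbours≤2 (nbr 0F) (nbr 1F) (nbr 2F)))
      where
      nbr : ∀ a → adjV (leg b j) (σV (leg a zero)) ≡ true
      nbr a = subst (λ x → adjV x (σV (leg a zero)) ≡ true) σcentre
                    (σV-preserves-adjacency {centre} {leg a zero} refl)
      distinct : ¬ (σV (leg 0F zero) ≡ σV (leg 1F zero) ⊎ σV (leg 0F zero) ≡ σV (leg 2F zero)
                    ⊎ σV (leg 1F zero) ≡ σV (leg 2F zero))
      distinct (inj₁ e) with () ← σV-injective {leg 0F zero} {leg 1F zero} e
      distinct (inj₂ (inj₁ e)) with () ← σV-injective {leg 0F zero} {leg 2F zero} e
      distinct (inj₂ (inj₂ e)) with () ← σV-injective {leg 1F zero} {leg 2F zero} e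

    firstImage : ∀ a → ∃ λ b → σV (leg a zero) ≡ leg b zero
    firstImage a = centreNeighbour (subst (λ x → adjV x (σV (leg a zero)) ≡ true) centre-fixed
                                          (σV-preserves-adjacency {centre} {leg a zero} refl))

    π : Fin L → Fin L
    π a = proj₁ (firstImage a)

    -- Outwards induction along leg a, keeping track of the parent as well:
    -- the image of vertex j+1 is a neighbour of leg (π a) j other than its parent.
    legwise : ∀ a j → σV (leg a j) ≡ leg (π a) j
    legwise a j = proj₁ (<-weakInduction Mapped (proj₂ (firstImage a) , centre-fixed) next j)
      where
      Mapped : Fin m → Set
      Mapped j = σV (leg a j) ≡ leg (π a) j × σV (parent a j) ≡ parent (π a) j
      next : ∀ i → Mapped (inject₁ i) → Mapped (suc i)
      next i (onLeg , onParent) = outwards (legNeighbour adjacent) , onLeg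
        where
        adjacent : adjV (leg (π a) (inject₁ i)) (σV (leg a (suc i))) ≡ true
        adjacent = subst (λ x → adjV x (σV (leg a (suc i))) ≡ true) onLeg
                         (σV-preserves-adjacency {leg a (inject₁ i)} {leg a (suc i)}
                           (child⇒adjacent (child a (suc i) refl)))
        outwards : σV (leg a (suc i)) ≡ parent (π a) (inject₁ i)
                   ⊎ ChildOf (σV (leg a (suc i))) (leg (π a) (inject₁ i))
                   → σV (leg a (suc i)) ≡ leg (π a) (suc i)
        outwards (inj₁ e) = ⊥-elim (parent≢grandchild a i
          (σV-injective {leg a (suc i)} {parent a (inject₁ i)} (trans e (sym onParent))))
        outwards (inj₂ c) = children-unique c (child (π a) (suc i) refl) λ ()

    legFixed : ∀ a j → σV (leg a j) ≡ leg a j → π a ≡ a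
    legFixed a j e = proj₁ (leg-injective (trans (sym (legwise a j)) e))

    π-injective : Injective _≡_ _≡_ π
    π-injective {a} {b} e = proj₁ (leg-injective (σV-injective (begin
      σV (leg a zero)   ≡⟨ legwise a zero ⟩
      leg (π a) zero    ≡⟨ cong (λ c → leg c zero) e ⟩
      leg (π b) zero    ≡⟨ sym (legwise b zero) ⟩
      σV (leg b zero)   ∎)))
      where open ≡-Reasoning

    -- If π fixes every leg except possibly a₀, it fixes a₀ too
    -- (being injective), so σ is the identity.
    identityIfAllButOneLegFixed : ∀ a₀ → (∀ a → a ≢ a₀ → π a ≡ a) → ∀ v → σ ⟨$⟩ʳ v ≡ v
    identityIfAllButOneLegFixed a₀ fixed = σV-identity⇒identity σV-id
      where
      π-id : ∀ a → π a ≡ a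
      π-id a with a F.≟ a₀
      ... | no a≢a₀ = fixed a a≢a₀
      ... | yes refl with π a F.≟ a
      ...   | yes πa≡a = πa≡a
      ...   | no πa≢a = ⊥-elim (πa≢a (π-injective (fixed (π a) πa≢a)))
      σV-id : ∀ x → σV x ≡ x
      σV-id centre = centre-fixed
      σV-id (leg a j) = trans (legwise a j) (cong (λ c → leg c j) (π-id a))

  relabel : (Fin L → Fin L) → V → V
  relabel ρ centre = centre
  relabel ρ (leg a j) = leg (ρ a) j

  relabel-parent : ∀ ρ a j → relabel ρ (parent a j) ≡ parent (ρ a) j
  relabel-parent ρ a zero = refl
  relabel-parent ρ a (suc i) = refl

  relabel-injective : ∀ {ρ} → Injective _≡_ _≡_ ρ → Injective _≡_ _≡_ (relabel ρ)
  relabel-injective _ {centre} {centre} _ = refl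
  relabel-injective ρ-inj {leg a i} {leg _ _} e with leg-injective e
  ... | ρa≡ρb , refl = cong (λ c → leg c i) (ρ-inj ρa≡ρb)

  relabel-adj : ∀ {ρ} → Injective _≡_ _≡_ ρ → ∀ x y → adjV (relabel ρ x) (relabel ρ y) ≡ adjV x y
  relabel-adj {ρ} ρ-inj x y = cong₂ _∨_ (parentOf-relabel x y) (parentOf-relabel y x)
    where
    parentOf-relabel : ∀ x y → relabel ρ x parentOf relabel ρ y ≡ x parentOf y
    parentOf-relabel x centre = refl
    parentOf-relabel x (leg b j) =
      trans (cong (λ z → does (relabel ρ x ≟V z)) (sym (relabel-parent ρ b j)))
            (does-injective _≟V_ _≟V_ (relabel ρ) (relabel-injective ρ-inj) x (parent b j))

  relabel-inverse : ∀ {ρ ρ⁻¹} → (∀ a → ρ (ρ⁻¹ a) ≡ a) → ∀ x → relabel ρ (relabel ρ⁻¹ x) ≡ x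
  relabel-inverse inv centre = refl
  relabel-inverse inv (leg a j) = cong (λ c → leg c j) (inv a)

  module LegPermutation (ρ : Permutation′ L) where
    open Lift (relabel (ρ ⟨$⟩ʳ_)) (relabel (ρ ⟨$⟩ˡ_))
              (relabel-inverse (λ _ → inverseʳ ρ)) (relabel-inverse (λ _ → inverseˡ ρ)) public

    ρ-injective : Injective _≡_ _≡_ (ρ ⟨$⟩ʳ_)
    ρ-injective e = trans (sym (inverseˡ ρ)) (trans (cong (ρ ⟨$⟩ˡ_) e) (inverseˡ ρ))

    automorphism : IsAutomorphism graph lifted
    automorphism = lifted-automorphism (relabel-adj ρ-injective)

  Meets : (Fin N → Set) → Fin L → Set
  Meets P a = ∃ λ j → P (enc (leg a j))

  meets? : ∀ {P} → Decidable P → ∀ a → Dec (Meets P a)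
  meets? P? a = FP.any? λ j → P? (enc (leg a j))

  meetsAllButOne⇒fixing : ∀ P a₀ → (∀ a → a ≢ a₀ → Meets P a) → IsFixingPred graph P
  meetsAllButOne⇒fixing P a₀ meets σ aut σ-fixes-P =
    identityIfAllButOneLegFixed a₀ λ a a≢a₀ →
      legFixed a (proj₁ (meets a a≢a₀))
        (fixed⇒σV-fixed _ (σ-fixes-P _ (proj₂ (meets a a≢a₀))))
    where open Automorphism σ aut

  -- A fixing set cannot miss two legs a and b: swapping them would be an
  -- automorphism fixing the set and moving the first vertex of leg a.
  missesAtMostOne : ∀ {P} → IsFixingPred graph P → ∀ a b → ¬ Meets P a → ¬ Meets P b → a ≡ b
  missesAtMostOne {P} fixing a b missA missB = sym (proj₁ (leg-injective (enc-injective (begin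
    enc (leg b zero)                             ≡⟨ cong (λ c → enc (leg c zero)) (sym (transpose-first a b)) ⟩
    enc (relabel (swap ⟨$⟩ʳ_) (leg a zero))      ≡⟨ sym (lifted-enc (leg a zero)) ⟩
    lifted ⟨$⟩ʳ enc (leg a zero)                 ≡⟨ fixing lifted automorphism swap-fixes-P (enc (leg a zero)) ⟩
    enc (leg a zero)                             ∎))))
    where
    swap : Permutation′ L
    swap = transpose a b
    open LegPermutation swap
    open ≡-Reasoning
    -- Every vertex of P is the centre or lies on a leg other than a and b.
    swap-fixes-P : ∀ v → P v → lifted ⟨$⟩ʳ v ≡ v
    swap-fixes-P = lifted-fixes P λ
      { centre _ → refl
      ; (leg c j) pc → cong (λ d → leg d j)
          (transpose-others (λ { refl → missA (j , pc) }) (λ { refl → missB (j , pc) })) }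

  fixing⇒meetsAllButOne : ∀ {P} → Decidable P → IsFixingPred graph P →
    ∃ λ a₀ → ∀ a → a ≢ a₀ → Meets P a
  fixing⇒meetsAllButOne {P} P? fixing with FP.any? (λ a → ¬? (meets? P? a))
  ... | yes (a₀ , missA₀) = a₀ , λ a a≢a₀ → decidable-stable (meets? P? a)
          (λ missA → a≢a₀ (missesAtMostOne fixing a a₀ missA missA₀))
  ... | no noneMissed = zero , λ a _ → decidable-stable (meets? P? a)
          (λ missA → noneMissed (a , missA))

  record Transversal (P : Fin N → Set) : Set where
    field
      position       : Fin k → Fin L × Fin m
      onDistinctLegs : Injective _≡_ _≡_ (proj₁ ∘ position)
      member         : ∀ t → P (enc (uncurry leg (position t)))

  -- A decidable fixing set has a transversal: enumerate the legs other than
  -- the possibly missed one a₀ by punchIn a₀.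
  fixing⇒transversal : ∀ {P} → Decidable P → IsFixingPred graph P → Transversal P
  fixing⇒transversal {P} P? fixing = record
    { position       = λ t → punchIn a₀ t , proj₁ (meetsLeg t)
    ; onDistinctLegs = FP.punchIn-injective a₀ _ _
    ; member         = λ t → proj₂ (meetsLeg t)
    }
    where
    a₀ : Fin L
    a₀ = proj₁ (fixing⇒meetsAllButOne P? fixing)
    meetsLeg : ∀ t → Meets P (punchIn a₀ t)
    meetsLeg t = proj₂ (fixing⇒meetsAllButOne P? fixing) (punchIn a₀ t) (FP.punchInᵢ≢i a₀ t)

  fixingSet-size : ∀ F → IsFixingSet graph F → k ≤ ∣ F ∣
  fixingSet-size F fixing = injection⇒≤∣∣ F (enc ∘ uncurry leg ∘ position) distinct member
    where
    open Transversal (fixing⇒transversal (λ v → v SP.∈? F) fixing)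
    distinct : Injective _≡_ _≡_ (enc ∘ uncurry leg ∘ position)
    distinct = onDistinctLegs ∘ proj₁ ∘ leg-injective ∘ enc-injective

  firstVertex : Fin k → Fin N
  firstVertex t = enc (leg (suc t) zero)

  firstVertices : Subset N
  firstVertices = image firstVertex

  firstVertices-fixing : IsFixingSet graph firstVertices
  firstVertices-fixing = meetsAllButOne⇒fixing (_∈ firstVertices) zero λ
    { zero 0≢0 → ⊥-elim (0≢0 refl)
    ; (suc t) _ → zero , ∈-image⁺ firstVertex t }

  firstVertices-size : ∣ firstVertices ∣ ≡ k
  firstVertices-size = ∣image∣ firstVertex (FP.suc-injective ∘ proj₁ ∘ leg-injective ∘ enc-injective)

  fixNumber : FixNumberIs graph k
  fixNumber = (firstVertices , firstVertices-fixing , firstVertices-size) , fixingSet-size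

  -- The classes of a fixatic partition into q classes are disjoint and each
  -- has a transversal, giving q·k distinct positions on the legs.
  fixatic-bound : ∀ q (c : Fin N → Fin q) → IsFixaticPartition graph q c → q * k ≤ L * m
  fixatic-bound q c (_ , fixing) = pairInjection⇒*≤ positions positions-injective
    where
    transversal : (i : Fin q) → Transversal (λ v → c v ≡ i)
    transversal i = fixing⇒transversal (λ v → c v F.≟ i) (fixing i)
    open Transversal
    positions : Fin q × Fin k → Fin L × Fin m
    positions (i , t) = position (transversal i) t
    positions-injective : Injective _≡_ _≡_ positions
    positions-injective {i , t} {i′ , t′} e
      with trans (sym (member (transversal i) t))
                 (trans (cong (c ∘ enc ∘ uncurry leg) e) (member (transversal i′) t′))
    ... | refl = cong (i ,_) (onDistinctLegs (transversal i) (cong proj₁ e))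

-- The balanced spider: k + 1 legs of length k, where k = 2 + r (so m = k).
module Balanced (r : ℕ) where
  open Spider r (suc r) public

  -- Vertex j of leg a lies in class punchIn a j; the centre may go anywhere.
  class : V → Fin L
  class centre = zero
  class (leg a j) = punchIn a j

  partition : Fin N → Fin L
  partition = class ∘ dec

  classMeets : ∀ i a → a ≢ i → Meets (λ v → partition v ≡ i) a
  classMeets i a a≢i = punchOut a≢i ,
    trans (cong class (dec-enc (leg a (punchOut a≢i)))) (FP.punchIn-punchOut a≢i)

  partition-fixatic : IsFixaticPartition graph L partition
  partition-fixatic = nonempty , λ i → meetsAllButOne⇒fixing _ i (classMeets i)
    where
    nonempty : ∀ i → ∃ λ v → partition v ≡ i
    nonempty i = enc (leg a (proj₁ meets)) , proj₂ meets
      where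
      a : Fin L
      a = punchIn i zero
      meets : Meets (λ v → partition v ≡ i) a
      meets = classMeets i a (FP.punchInᵢ≢i i zero)

  -- F_xt(G) = k + 1: any fixatic partition into q classes has q·k ≤ (k + 1)·k.
  fixaticNumber : FixaticNumberIs graph L
  fixaticNumber = (partition , partition-fixatic) ,
    λ q c fixatic → ℕP.*-cancelʳ-≤ q L k (fixatic-bound q c fixatic)

mainTheorem16 : ∀ (t : ℕ) → 2 ≤ t →
    Σ Graph λ G → Connected G × FixNumberIs G t × FixaticNumberIs G (suc t)
mainTheorem16 (suc (suc r)) (s≤s (s≤s z≤n)) = graph , connected , fixNumber , fixaticNumber
  where open Balanced r
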